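{- Let $p,q$ be positive integers with $p/q\ge4$, let $k=\lfloor p/q\rfloor$, $r=p-kq$, assume $r\ge1$, and let $t$ be the smallest positive integer with $(t+1)q\equiv r\pmod p$. Let $uv$ be an edge of a graph that also contains two paths $P_{uv}=u\,x_0x_1\cdots x_t\,v$ and $P_{vu}=v\,z_0z_1\cdots z_t\,u$ which are internally disjoint from each other and from $\{u,v\}$. Let $\psi$ be a $(p,q)$-colouring of the subgraph formed by $uv$, $P_{uv}$ and $P_{vu}$ such that $\psi(x_i),\psi(z_i)\in L_i$ for all $0\le i\le t$, where $L_0=L_t=[p-1,2q-1]$ and $L_i=[iq,(i+2)q-1]$ for $1\le i\le t-1$. Then $\psi(u)$ and $\psi(v)$ are not both contained in $S_0=[0,q+r-1]$.
   Context: All arithmetic on colours is modulo $p$. For $a,b\in\{0,\dots,p-1\}$ the interval $[a,b]$ is the cyclic interval $\{a,a+1,\dots,b\}$ (addition mod $p$). A $(p,q)$-colouring of a graph $H$ is a map $\psi:V(H)\to\{0,\dots,p-1\}$ with $q\le|\psi(x)-\psi(y)|\le p-q$ for every edge $xy$. -}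

module Defs where

open import Data.Nat using (ℕ; zero; suc; _+_; _*_; _∸_; _≤_; _<_; ∣_-_∣; NonZero)
open import Data.Nat.DivMod using (_%_)
open import Data.Product using (_×_)
open import Data.Sum using (_⊎_)
open import Relation.Binary.PropositionalEquality using (_≡_)

-- c lies in the cyclic interval [a,b] = {a, a+1, ..., b} (mod p):
-- the cyclic offset of c from a is at most the cyclic offset of b from a.
InCyc : (p : ℕ) .{{_ : NonZero p}} → ℕ → ℕ → ℕ → Set
InCyc p a b c = ((c + p ∸ a % p) % p) ≤ ((b % p + p ∸ a % p) % p)

EdgeOK : ℕ → ℕ → ℕ → ℕ → Set
EdgeOK p q a b = (q ≤ ∣ a - b ∣) × (∣ a - b ∣ ≤ p ∸ q)

InL : (p : ℕ) .{{_ : NonZero p}} → ℕ → ℕ → ℕ → ℕ → Set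
InL p q t i c =
  ((i ≡ 0 ⊎ i ≡ t) → InCyc p (p ∸ 1) (2 * q ∸ 1) c) ×
  ((1 ≤ i × suc i ≤ t) → InCyc p (i * q) ((i + 2) * q ∸ 1) c)

module Submission where

-- Let a + q ≤ b be the colours of the two ends of the edge uv, both in [0, q + r − 1], so a < r
-- (otherwise exchange the roles of the two paths), and follow the path from the end coloured a to
-- the end coloured b. Each colour ψ(y_i) with i < t lies in the window [iq + a + q, (i + 2)q − 1]:
-- ψ(y_{i+1}) ∈ L_{i+1} has offset in [q, 3q) from iq, and being at distance at least q from ψ(y_i)
-- forces this offset to exceed that of ψ(y_i) by at least q. As (t + 1)q ≡ r (mod p), the window
-- of y_{t−1} is [a + r − q, r − 1], which forces ψ(y_t) ∈ L_t into [a + r, 2q − 1]; but no such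
-- colour is at distance at least q from b ∈ [a + q, q + r − 1].

open import Defs
open import Data.Empty using (⊥; ⊥-elim)
open import Data.Nat
open import Data.Nat.DivMod
open import Data.Nat.Properties
open import Data.Nat.Tactic.RingSolver using (solve-∀)
open import Data.Product using (_×_; _,_; proj₁; proj₂; ∃-syntax)
open import Data.Sum using (_⊎_; inj₁; inj₂; [_,_]′)
open import Relation.Binary.PropositionalEquality
open import Relation.Nullary using (¬_; yes; no)

≤∸1⇒< : ∀ {m n} → 1 ≤ n → m ≤ n ∸ 1 → m < n
≤∸1⇒< {n = suc _} _ = s≤s

2*n≡n+n : ∀ n → 2 * n ≡ n + n
2*n≡n+n n = cong (n +_) (+-identityʳ n)

m<n⇒n+m<2n : ∀ {m n} → m < n → n + m < 2 * n
m<n⇒n+m<2n {m} {n} m<n = subst (n + m <_) (sym (2*n≡n+n n)) (+-monoʳ-< n m<n)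

m+n≤o<2n⇒m<n : ∀ {m n o} → m + n ≤ o → o < 2 * n → m < n
m+n≤o<2n⇒m<n {m} {n} {o} m+n≤o o<2n =
  +-cancelʳ-< n m n (≤-<-trans m+n≤o (subst (o <_) (2*n≡n+n n) o<2n))

module Modular (p : ℕ) .{{_ : NonZero p}} where
  open ≡-Reasoning

  [m%p+n]%p≡[m+n]%p : ∀ m n → (m % p + n) % p ≡ (m + n) % p
  [m%p+n]%p≡[m+n]%p m n = begin
    (m % p + n) % p         ≡⟨ %-distribˡ-+ (m % p) n p ⟩
    (m % p % p + n % p) % p ≡⟨ cong (λ x → (x + n % p) % p) (m%n%n≡m%n m p) ⟩
    (m % p + n % p) % p     ≡⟨ %-distribˡ-+ m n p ⟨
    (m + n) % p             ∎

  [m+n%p]%p≡[m+n]%p : ∀ m n → (m + n % p) % p ≡ (m + n) % p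
  [m+n%p]%p≡[m+n]%p m n = begin
    (m + n % p) % p ≡⟨ cong (_% p) (+-comm m (n % p)) ⟩
    (n % p + m) % p ≡⟨ [m%p+n]%p≡[m+n]%p n m ⟩
    (n + m) % p     ≡⟨ cong (_% p) (+-comm n m) ⟩
    (m + n) % p     ∎

  [m+o+[p∸o]]%p≡m%p : ∀ m {o} → o ≤ p → (m + o + (p ∸ o)) % p ≡ m % p
  [m+o+[p∸o]]%p≡m%p m {o} o≤p = begin
    (m + o + (p ∸ o)) % p   ≡⟨ cong (_% p) (+-assoc m o (p ∸ o)) ⟩
    (m + (o + (p ∸ o))) % p ≡⟨ cong (λ x → (m + x) % p) (m+[n∸m]≡n o≤p) ⟩
    (m + p) % p             ≡⟨ [m+n]%n≡m%n m p ⟩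
    m % p                   ∎

  %-cancelʳ-+ : ∀ m n {o} → o ≤ p → (m + o) % p ≡ (n + o) % p → m % p ≡ n % p
  %-cancelʳ-+ m n {o} o≤p eq = begin
    m % p                       ≡⟨ [m+o+[p∸o]]%p≡m%p m o≤p ⟨
    (m + o + (p ∸ o)) % p       ≡⟨ [m%p+n]%p≡[m+n]%p (m + o) (p ∸ o) ⟨
    ((m + o) % p + (p ∸ o)) % p ≡⟨ cong (λ x → (x + (p ∸ o)) % p) eq ⟩
    ((n + o) % p + (p ∸ o)) % p ≡⟨ [m%p+n]%p≡[m+n]%p (n + o) (p ∸ o) ⟩
    (n + o + (p ∸ o)) % p       ≡⟨ [m+o+[p∸o]]%p≡m%p n o≤p ⟩
    n % p                       ∎

  [p∸1+n]%p≡[n∸1]%p : ∀ {n} → 1 ≤ n → (p ∸ 1 + n) % p ≡ (n ∸ 1) % p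
  [p∸1+n]%p≡[n∸1]%p {suc n} _ = begin
    (p ∸ 1 + suc n) % p   ≡⟨ cong (_% p) (+-assoc (p ∸ 1) 1 n) ⟨
    (p ∸ 1 + 1 + n) % p   ≡⟨ cong (λ x → (x + n) % p) (m∸n+n≡m (>-nonZero⁻¹ p)) ⟩
    (p + n) % p           ≡⟨ cong (_% p) (+-comm p n) ⟩
    (n + p) % p           ≡⟨ [m+n]%n≡m%n n p ⟩
    n % p                 ∎

  offset : ℕ → ℕ → ℕ
  offset a c = (c + p ∸ a % p) % p

  +-offset : ∀ a {c} → c < p → (a + offset a c) % p ≡ c
  +-offset a {c} c<p = begin
    (a + offset a c) % p          ≡⟨ [m+n%p]%p≡[m+n]%p a (c + p ∸ a % p) ⟩
    (a + (c + p ∸ a % p)) % p     ≡⟨ [m%p+n]%p≡[m+n]%p a (c + p ∸ a % p) ⟨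
    (a % p + (c + p ∸ a % p)) % p ≡⟨ cong (_% p) (m+[n∸m]≡n (≤-trans (m%n≤n a p) (m≤n+m p c))) ⟩
    (c + p) % p                   ≡⟨ [m+n]%n≡m%n c p ⟩
    c % p                         ≡⟨ m<n⇒m%n≡m c<p ⟩
    c                             ∎

  offset-+ : ∀ a {e} → e < p → offset a ((a + e) % p) ≡ e
  offset-+ a {e} e<p = begin
    offset a ((a + e) % p) ≡⟨ %-cancelʳ-+ ((a + e) % p + p ∸ a % p) e (m%n≤n a p) shifted ⟩
    e % p                  ≡⟨ m<n⇒m%n≡m e<p ⟩
    e                      ∎
    where
    shifted : ((a + e) % p + p ∸ a % p + a % p) % p ≡ (e + a % p) % p
    shifted = begin
      ((a + e) % p + p ∸ a % p + a % p) % p ≡⟨ cong (_% p) (m∸n+n≡m (≤-trans (m%n≤n a p) (m≤n+m p _))) ⟩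
      ((a + e) % p + p) % p                 ≡⟨ [m+n]%n≡m%n ((a + e) % p) p ⟩
      (a + e) % p % p                       ≡⟨ m%n%n≡m%n (a + e) p ⟩
      (a + e) % p                           ≡⟨ [m%p+n]%p≡[m+n]%p a e ⟨
      (a % p + e) % p                       ≡⟨ cong (_% p) (+-comm (a % p) e) ⟩
      (e + a % p) % p                       ∎

  InCyc⇒offset : ∀ a b {c e} → c < p → e < p → b % p ≡ (a + e) % p → InCyc p a b c →
                 ∃[ d ] d ≤ e × (a + d) % p ≡ c
  InCyc⇒offset a b {c} c<p e<p b≡a+e c∈[a,b] =
    offset a c , subst (offset a c ≤_) (trans (cong (offset a) b≡a+e) (offset-+ a e<p)) c∈[a,b] , +-offset a c<p

  InCyc-0⇒< : ∀ {m c} → 1 ≤ m → m ≤ p → c < p → InCyc p 0 (m ∸ 1) c → c < m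
  InCyc-0⇒< {m} 1≤m m≤p c<p c∈[0,m∸1]
    with InCyc⇒offset 0 (m ∸ 1) c<p (<-≤-trans (≤∸1⇒< 1≤m ≤-refl) m≤p) refl c∈[0,m∸1]
  ... | d , d≤m∸1 , d%p≡c = subst (_< m) (trans (sym (m<n⇒m%n≡m d<p)) d%p≡c) d<m
    where
    d<m : d < m
    d<m = ≤∸1⇒< 1≤m d≤m∸1
    d<p : d < p
    d<p = <-≤-trans d<m m≤p

module Separation (p q : ℕ) .{{_ : NonZero p}} (q≤p : q ≤ p) where
  open Modular p

  EdgeOK-sym : ∀ a b → EdgeOK p q a b → EdgeOK p q b a
  EdgeOK-sym a b = subst (λ d → q ≤ d × d ≤ p ∸ q) (∣-∣-comm a b)

  ¬EdgeOK-close : ∀ {α δ} → α < p → δ < q → ¬ EdgeOK p q α ((α + δ) % p)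
  ¬EdgeOK-close {α} {δ} α<p δ<q (q≤dist , dist≤p∸q) with α + δ <? p
  ... | yes α+δ<p = <⇒≱ δ<q (subst (q ≤_) unwrapped q≤dist)
    where
    unwrapped : ∣ α - (α + δ) % p ∣ ≡ δ
    unwrapped = trans (cong (∣ α -_∣) (m<n⇒m%n≡m α+δ<p)) (∣m-m+n∣≡n α δ)
  ... | no α+δ≮p = <⇒≱ δ<q (∸-cancelʳ-≤ q≤p (subst (_≤ p ∸ q) wrapped dist≤p∸q))
    where
    open ≡-Reasoning
    δ≤p : δ ≤ p
    δ≤p = ≤-trans (<⇒≤ δ<q) q≤p
    w : ℕ
    w = α + δ ∸ p
    α+δ≡w+p : α + δ ≡ w + p
    α+δ≡w+p = sym (m∸n+n≡m (≮⇒≥ α+δ≮p))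
    w<p : w < p
    w<p = +-cancelʳ-< p w p (subst (_< p + p) α+δ≡w+p (+-mono-<-≤ α<p δ≤p))
    wrapped : ∣ α - (α + δ) % p ∣ ≡ p ∸ δ
    wrapped = begin
      ∣ α - (α + δ) % p ∣ ≡⟨ cong (λ x → ∣ α - x % p ∣) α+δ≡w+p ⟩
      ∣ α - (w + p) % p ∣ ≡⟨ cong (λ x → ∣ α - x ∣) (trans ([m+n]%n≡m%n w p) (m<n⇒m%n≡m w<p)) ⟩
      ∣ α - w ∣           ≡⟨ ∣m+n-m+o∣≡∣n-o∣ δ α w ⟨
      ∣ δ + α - δ + w ∣   ≡⟨ cong₂ ∣_-_∣ (+-comm δ α) (+-comm δ w) ⟩
      ∣ α + δ - w + δ ∣   ≡⟨ cong ∣_- w + δ ∣ α+δ≡w+p ⟩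
      ∣ w + p - w + δ ∣   ≡⟨ ∣m+n-m+o∣≡∣n-o∣ w p δ ⟩
      ∣ p - δ ∣           ≡⟨ m≤n⇒∣n-m∣≡n∸m δ≤p ⟩
      p ∸ δ               ∎

  separated-offsets≤ : ∀ B {u v} → u ≤ v → EdgeOK p q ((B + u) % p) ((B + v) % p) → u + q ≤ v
  separated-offsets≤ B {u} {v} u≤v edge = ≮⇒≥ too-close
    where
    too-close : ¬ v < u + q
    too-close v<u+q = ¬EdgeOK-close (m%n<n (B + u) p) v∸u<q (subst (EdgeOK p q ((B + u) % p)) B+v≡ edge)
      where
      v∸u<q : v ∸ u < q
      v∸u<q = subst (v ∸ u <_) (m+n∸m≡n u q) (∸-monoˡ-< v<u+q u≤v)
      B+v≡ : (B + v) % p ≡ ((B + u) % p + (v ∸ u)) % p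
      B+v≡ = begin
        (B + v) % p               ≡⟨ cong (λ x → (B + x) % p) (m+[n∸m]≡n u≤v) ⟨
        (B + (u + (v ∸ u))) % p   ≡⟨ cong (_% p) (+-assoc B u (v ∸ u)) ⟨
        (B + u + (v ∸ u)) % p     ≡⟨ [m%p+n]%p≡[m+n]%p (B + u) (v ∸ u) ⟨
        ((B + u) % p + (v ∸ u)) % p ∎
        where open ≡-Reasoning

  separated-offsets : ∀ B {u v} → EdgeOK p q ((B + u) % p) ((B + v) % p) → u + q ≤ v ⊎ v + q ≤ u
  separated-offsets B {u} {v} edge with ≤-total u v
  ... | inj₁ u≤v = inj₁ (separated-offsets≤ B u≤v edge)
  ... | inj₂ v≤u = inj₂ (separated-offsets≤ B v≤u (EdgeOK-sym ((B + u) % p) ((B + v) % p) edge))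

  separated : ∀ {a b} → a < p → b < p → EdgeOK p q a b → a + q ≤ b ⊎ b + q ≤ a
  separated a<p b<p edge =
    separated-offsets 0 (subst₂ (EdgeOK p q) (sym (m<n⇒m%n≡m a<p)) (sym (m<n⇒m%n≡m b<p)) edge)

module Lists (p q : ℕ) .{{_ : NonZero p}} .{{_ : NonZero q}} (2q<p : 2 * q < p) where
  open Modular p

  1≤2q : 1 ≤ 2 * q
  1≤2q = ≤-trans (>-nonZero⁻¹ q) (m≤m+n q (q + 0))

  p∸1<p : p ∸ 1 < p
  p∸1<p = ≤∸1⇒< (>-nonZero⁻¹ p) ≤-refl

  InCyc-end⇒ : ∀ {c} → c < p → InCyc p (p ∸ 1) (2 * q ∸ 1) c → c ≡ p ∸ 1 ⊎ c < 2 * q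
  InCyc-end⇒ {c} c<p c∈L
    with InCyc⇒offset (p ∸ 1) (2 * q ∸ 1) c<p 2q<p (sym ([p∸1+n]%p≡[n∸1]%p 1≤2q)) c∈L
  ... | zero , _ , p∸1+0≡c =
    inj₁ (trans (sym p∸1+0≡c) (trans (cong (_% p) (+-identityʳ (p ∸ 1))) (m<n⇒m%n≡m p∸1<p)))
  ... | suc d , d<2q , p∸1+1+d≡c = inj₂ (subst (_< 2 * q) d≡c d<2q)
    where
    d≡c : d ≡ c
    d≡c = trans (sym (m<n⇒m%n≡m (<-trans d<2q 2q<p)))
                (trans (sym ([p∸1+n]%p≡[n∸1]%p (s≤s z≤n))) p∸1+1+d≡c)

  [[i+2]q∸1]%p≡[iq+[2q∸1]]%p : ∀ i → ((i + 2) * q ∸ 1) % p ≡ (i * q + (2 * q ∸ 1)) % p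
  [[i+2]q∸1]%p≡[iq+[2q∸1]]%p i =
    cong (_% p) (trans (cong (_∸ 1) (*-distribʳ-+ q i 2)) (+-∸-assoc (i * q) 1≤2q))

  InCyc-mid⇒ : ∀ i {c} → c < p → InCyc p (i * q) ((i + 2) * q ∸ 1) c →
               ∃[ d ] d < 2 * q × (i * q + d) % p ≡ c
  InCyc-mid⇒ i c<p c∈L
    with InCyc⇒offset (i * q) ((i + 2) * q ∸ 1) c<p (≤-<-trans (m∸n≤m (2 * q) 1) 2q<p)
                      ([[i+2]q∸1]%p≡[iq+[2q∸1]]%p i) c∈L
  ... | d , d≤2q∸1 , iq+d≡c = d , ≤∸1⇒< 1≤2q d≤2q∸1 , iq+d≡c

module Path (p q : ℕ) .{{_ : NonZero p}} .{{_ : NonZero q}} (2q<p : 2 * q < p)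
            (r : ℕ) (r<q : r < q) (s : ℕ) ([s+2]q≡r : ((suc s + 1) * q) % p ≡ r) where
  open Modular p
  open Lists p q 2q<p

  q≤p : q ≤ p
  q≤p = ≤-trans (m≤m+n q (q + 0)) (<⇒≤ 2q<p)

  open Separation p q q≤p

  -- With n = 2q − r − 1, the base sq + n + 1 is a multiple of p, so the colour p − 1 has offset n from sq.
  n : ℕ
  n = q + (q ∸ suc r)

  q≤n : q ≤ n
  q≤n = m≤m+n q (q ∸ suc r)

  1+n+r≡q+q : suc n + r ≡ q + q
  1+n+r≡q+q = trans (rearrange q (q ∸ suc r) r) (cong (q +_) (m+[n∸m]≡n r<q))
    where
    rearrange : ∀ x y z → suc (x + y) + z ≡ x + (suc z + y)
    rearrange = solve-∀

  j : ℕ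
  j = ((suc s + 1) * q) / p

  sq+1+n≡jp : s * q + suc n ≡ j * p
  sq+1+n≡jp = +-cancelʳ-≡ r _ _ (begin
    s * q + suc n + r                       ≡⟨ +-assoc (s * q) (suc n) r ⟩
    s * q + (suc n + r)                     ≡⟨ cong (s * q +_) 1+n+r≡q+q ⟩
    s * q + (q + q)                         ≡⟨ unfold s q ⟩
    (suc s + 1) * q                         ≡⟨ m≡m%n+[m/n]*n ((suc s + 1) * q) p ⟩
    ((suc s + 1) * q) % p + j * p           ≡⟨ cong (_+ j * p) [s+2]q≡r ⟩
    r + j * p                               ≡⟨ +-comm r (j * p) ⟩
    j * p + r                               ∎)
    where
    open ≡-Reasoning
    unfold : ∀ x y → x * y + (y + y) ≡ (suc x + 1) * y
    unfold = solve-∀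

  [c+sq+1+n]%p≡c%p : ∀ c → (c + (s * q + suc n)) % p ≡ c % p
  [c+sq+1+n]%p≡c%p c = trans (cong (λ x → (c + x) % p) sq+1+n≡jp) ([m+kn]%n≡m%n c j p)

  [sq+n]%p≡p∸1 : (s * q + n) % p ≡ p ∸ 1
  [sq+n]%p≡p∸1 = begin
    (s * q + n) % p               ≡⟨ cong (λ x → (x ∸ 1) % p) (+-suc (s * q) n) ⟨
    (s * q + suc n ∸ 1) % p       ≡⟨ [p∸1+n]%p≡[n∸1]%p (≤-trans (s≤s z≤n) (m≤n+m (suc n) (s * q))) ⟨
    (p ∸ 1 + (s * q + suc n)) % p ≡⟨ [c+sq+1+n]%p≡c%p (p ∸ 1) ⟩
    (p ∸ 1) % p                   ≡⟨ m<n⇒m%n≡m p∸1<p ⟩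
    p ∸ 1                         ∎
    where open ≡-Reasoning

  [sq+[1+n+c]]%p≡c : ∀ {c} → c < p → (s * q + (suc n + c)) % p ≡ c
  [sq+[1+n+c]]%p≡c {c} c<p =
    trans (cong (_% p) (rearrange (s * q) (suc n) c)) (trans ([c+sq+1+n]%p≡c%p c) (m<n⇒m%n≡m c<p))
    where
    rearrange : ∀ x y z → x + (y + z) ≡ z + (x + y)
    rearrange = solve-∀

  module _ {a b : ℕ} (a+q≤b : a + q ≤ b) (b<q+r : b < q + r) (y : ℕ → ℕ)
           (y<p : ∀ i → i ≤ suc s → y i < p)
           (edge-a : EdgeOK p q a (y 0))
           (edge : ∀ i → i < suc s → EdgeOK p q (y i) (y (suc i)))
           (edge-b : EdgeOK p q (y (suc s)) b)
           (y∈L : ∀ i → i ≤ suc s → InL p q (suc s) i (y i)) where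

    m+q≤b⇒m<r : ∀ {m} → m + q ≤ b → m < r
    m+q≤b⇒m<r {m} m+q≤b = +-cancelʳ-< q m r (≤-<-trans m+q≤b (subst (b <_) (+-comm q r) b<q+r))

    a<q : a < q
    a<q = <-trans (m+q≤b⇒m<r a+q≤b) r<q

    b<p : b < p
    b<p = <-trans b<q+r (<-trans (m<n⇒n+m<2n r<q) 2q<p)

    InWindow : ℕ → ℕ → Set
    InWindow i c = ∃[ d ] a + q ≤ d × d < 2 * q × (i * q + d) % p ≡ c

    window₀ : InWindow 0 (y 0)
    window₀ with InCyc-end⇒ (y<p 0 z≤n) (proj₁ (y∈L 0 z≤n) (inj₁ refl))
    ... | inj₁ y₀≡p∸1 with separated-offsets (p ∸ 1) {suc a} {0} (subst₂ (EdgeOK p q) a≡ y₀≡ edge-a)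
      where
      a≡ : a ≡ (p ∸ 1 + suc a) % p
      a≡ = sym (trans ([p∸1+n]%p≡[n∸1]%p (s≤s z≤n)) (m<n⇒m%n≡m (<-≤-trans a<q q≤p)))
      y₀≡ : y 0 ≡ (p ∸ 1 + 0) % p
      y₀≡ = trans y₀≡p∸1 (sym (trans (cong (_% p) (+-identityʳ (p ∸ 1))) (m<n⇒m%n≡m p∸1<p)))
    ...   | inj₂ q≤1+a = ⊥-elim (<⇒≱ r<q (≤-trans q≤1+a (m+q≤b⇒m<r a+q≤b)))
    window₀ | inj₂ y₀<2q with separated (<-≤-trans a<q q≤p) (y<p 0 z≤n) edge-a
    ... | inj₁ a+q≤y₀ = y 0 , a+q≤y₀ , y₀<2q , m<n⇒m%n≡m (y<p 0 z≤n)
    ... | inj₂ y₀+q≤a = ⊥-elim (<⇒≱ a<q (≤-trans (m≤n+m q (y 0)) y₀+q≤a))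

    window-step : ∀ i → suc i ≤ s → InWindow i (y i) → InWindow (suc i) (y (suc i))
    window-step i i<s (d , a+q≤d , d<2q , yᵢ≡)
      with InCyc-mid⇒ (suc i) (y<p (suc i) (m≤n⇒m≤1+n i<s))
                      (proj₂ (y∈L (suc i) (m≤n⇒m≤1+n i<s)) (s≤s z≤n , s≤s i<s))
    ... | d′ , d′<2q , yᵢ₊₁≡ with separated-offsets (i * q) {d} {q + d′}
                                   (subst₂ (EdgeOK p q) (sym yᵢ≡) (trans (sym yᵢ₊₁≡) (cong (_% p) (rearrange (i * q) q d′)))
                                           (edge i (m≤n⇒m≤1+n i<s)))
      where
      rearrange : ∀ x y z → y + x + z ≡ x + (y + z)
      rearrange = solve-∀
    ...   | inj₁ d+q≤q+d′ = d′ , ≤-trans a+q≤d (+-cancelʳ-≤ q d d′ (subst (d + q ≤_) (+-comm q d′) d+q≤q+d′)) , d′<2q , yᵢ₊₁≡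
    ...   | inj₂ q+d′+q≤d = ⊥-elim (<⇒≱ (m+n≤o<2n⇒m<n q+d′+q≤d d<2q) (m≤m+n q d′))

    window : ∀ i → i ≤ s → InWindow i (y i)
    window zero    _   = window₀
    window (suc i) i<s = window-step i i<s (window i (<⇒≤ i<s))

    last-colour : a + r ≤ y (suc s) × y (suc s) < 2 * q
    last-colour with window s ≤-refl | InCyc-end⇒ (y<p (suc s) ≤-refl) (proj₁ (y∈L (suc s) ≤-refl) (inj₂ refl))
    ... | d , a+q≤d , d<2q , yₛ≡ | inj₁ yₜ≡p∸1
      with separated-offsets (s * q) {d} {n}
             (subst₂ (EdgeOK p q) (sym yₛ≡) (trans yₜ≡p∸1 (sym [sq+n]%p≡p∸1)) (edge s ≤-refl))
    ...   | inj₁ d+q≤n = ⊥-elim (<⇒≱ n<q+q (≤-trans q+q≤d+q d+q≤n))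
      where
      q+q≤d+q : q + q ≤ d + q
      q+q≤d+q = +-monoˡ-≤ q (≤-trans (m≤n+m q a) a+q≤d)
      n<q+q : n < q + q
      n<q+q = subst (n <_) 1+n+r≡q+q (s≤s (m≤m+n n r))
    ...   | inj₂ n+q≤d = ⊥-elim (<⇒≱ (m+n≤o<2n⇒m<n n+q≤d d<2q) q≤n)
    last-colour | d , a+q≤d , d<2q , yₛ≡ | inj₂ yₜ<2q
      with separated-offsets (s * q) {d} {suc n + yₜ}
             (subst₂ (EdgeOK p q) (sym yₛ≡) (sym ([sq+[1+n+c]]%p≡c yₜ<p)) (edge s ≤-refl))
      where
      yₜ : ℕ
      yₜ = y (suc s)
      yₜ<p : yₜ < p
      yₜ<p = y<p (suc s) ≤-refl
    ... | inj₁ d+q≤1+n+yₜ = +-cancelˡ-≤ (suc n) (a + r) (y (suc s)) (begin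
            suc n + (a + r) ≡⟨ rearrange (suc n) a r ⟩
            a + (suc n + r) ≡⟨ cong (a +_) 1+n+r≡q+q ⟩
            a + (q + q)     ≡⟨ +-assoc a q q ⟨
            a + q + q       ≤⟨ +-monoˡ-≤ q a+q≤d ⟩
            d + q           ≤⟨ d+q≤1+n+yₜ ⟩
            suc n + y (suc s) ∎) , yₜ<2q
      where
      open ≤-Reasoning
      rearrange : ∀ x y z → x + (y + z) ≡ y + (x + z)
      rearrange = solve-∀
    ... | inj₂ 1+n+yₜ+q≤d =
      ⊥-elim (<⇒≱ (m+n≤o<2n⇒m<n 1+n+yₜ+q≤d d<2q) (≤-trans q≤n (≤-trans (n≤1+n n) (m≤m+n (suc n) (y (suc s))))))

    impossible : ⊥
    impossible with last-colour | separated (y<p (suc s) ≤-refl) b<p edge-b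
    ... | a+r≤yₜ , _ | inj₁ yₜ+q≤b = <⇒≱ (m+q≤b⇒m<r yₜ+q≤b) (≤-trans (m≤n+m r a) a+r≤yₜ)
    ... | _ , yₜ<2q  | inj₂ b+q≤yₜ = <⇒≱ (m+n≤o<2n⇒m<n b+q≤yₜ yₜ<2q) (≤-trans (m≤n+m q a) a+q≤b)

4q≤p⇒2q<p : ∀ {p q} .{{_ : NonZero q}} → 4 * q ≤ p → 2 * q < p
4q≤p⇒2q<p {q = q} 4q≤p = <-≤-trans (*-monoˡ-< q {2} {4} (s≤s (s≤s (s≤s z≤n)))) 4q≤p

proposition3p2 : (p q : ℕ) .{{_ : NonZero p}} .{{_ : NonZero q}} →
    4 * q ≤ p →
    1 ≤ p ∸ (p / q) * q →
    (t : ℕ) → 1 ≤ t →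
    ((t + 1) * q) % p ≡ (p ∸ (p / q) * q) % p →
    (∀ s → 1 ≤ s → ((s + 1) * q) % p ≡ (p ∸ (p / q) * q) % p → t ≤ s) →
    (ψu ψv : ℕ) (x z : ℕ → ℕ) →
    ψu < p → ψv < p → (∀ i → i ≤ t → (x i < p) × (z i < p)) →
    EdgeOK p q ψu ψv →
    EdgeOK p q ψu (x 0) →
    (∀ i → i < t → EdgeOK p q (x i) (x (suc i))) →
    EdgeOK p q (x t) ψv →
    EdgeOK p q ψv (z 0) →
    (∀ i → i < t → EdgeOK p q (z i) (z (suc i))) →
    EdgeOK p q (z t) ψu →
    (∀ i → i ≤ t → InL p q t i (x i) × InL p q t i (z i)) →
    ¬ (InCyc p 0 (q + (p ∸ (p / q) * q) ∸ 1) ψu × InCyc p 0 (q + (p ∸ (p / q) * q) ∸ 1) ψv)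
proposition3p2 p q 4q≤p _ zero ()
proposition3p2 p q 4q≤p _ (suc s) _ [t+1]q≡r _ ψu ψv x z ψu<p ψv<p xz<p
               uv ux xx xv vz zz zu xz∈L (ψu∈S₀ , ψv∈S₀) =
  [ (λ u+q≤v → P.impossible u+q≤v ψv<q+r x (λ i i≤t → proj₁ (xz<p i i≤t)) ux xx xv (λ i i≤t → proj₁ (xz∈L i i≤t)))
  , (λ v+q≤u → P.impossible v+q≤u ψu<q+r z (λ i i≤t → proj₂ (xz<p i i≤t)) vz zz zu (λ i i≤t → proj₂ (xz∈L i i≤t)))
  ]′ (Separation.separated p q P.q≤p ψu<p ψv<p uv)
  where
  r : ℕ
  r = p ∸ (p / q) * q
  r<q : r < q
  r<q = subst (_< q) (m%n≡m∸m/n*n p q) (m%n<n p q)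
  2q<p : 2 * q < p
  2q<p = 4q≤p⇒2q<p 4q≤p
  q+r<p : q + r < p
  q+r<p = <-trans (m<n⇒n+m<2n r<q) 2q<p
  module P = Path p q 2q<p r r<q s (trans [t+1]q≡r (m<n⇒m%n≡m (<-trans r<q (≤-<-trans (m≤m+n q r) q+r<p))))
  S₀⇒< : ∀ {c} → c < p → InCyc p 0 (q + r ∸ 1) c → c < q + r
  S₀⇒< = Modular.InCyc-0⇒< p (≤-trans (>-nonZero⁻¹ q) (m≤m+n q r)) (<⇒≤ q+r<p)
  ψu<q+r : ψu < q + r
  ψu<q+r = S₀⇒< ψu<p ψu∈S₀
  ψv<q+r : ψv < q + r
  ψv<q+r = S₀⇒< ψv<p ψv∈S₀
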